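{- Let $G=(V,E)$ be a finite connected graph and let $\mathcal{C}$ be a cut-partition of $G$ such that no shortest path in $G$ contains two edges of the same cut $C\in\mathcal{C}$. For $v\in V$ let $h_v$ denote the minimum size of a set of vertices that intersects the vertex set $V\setminus C(v)$ for every $C\in\mathcal{C}$. Then the hull number of $G$ equals $\min_{v\in V}h_v+1$.
   Context: A cut of $G$ is an inclusion-minimal set of edges whose removal disconnects $G$; its removal leaves exactly two connected components, its sides. A cut-partition is a set of cuts partitioning $E$. For a vertex $v$ and a cut $C$, $C(v)$ denotes the side of $C$ containing $v$, so $V\setminus C(v)$ is the vertex set of the other side. A subgraph is convex if it contains every shortest path of $G$ between any two of its vertices; the convex hull of a vertex set is the smallest convex subgraph containing it. The hull number of $G$ is the minimum size of a vertex set whose convex hull is $G$. -}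

module Defs where

open import Data.Nat using (ℕ; suc; _≤_)
open import Data.Bool using (Bool; T)
open import Data.Fin using (Fin)
open import Data.Fin.Subset using (Subset; _∈_; _⊆_; ∣_∣)
open import Data.Product using (Σ; Σ-syntax; _×_; _,_)
open import Data.List as L using (List; []; _∷_)
open import Data.List.Relation.Unary.All using (All)
open import Relation.Nullary using (¬_)
open import Data.Empty using (⊥)
open import Relation.Binary.PropositionalEquality using (_≡_; _≢_)

record Graph (n : ℕ) : Set where
  field
    Adj    : Fin n → Fin n → Bool
    sym    : ∀ u v → T (Adj u v) → T (Adj v u)
    irrefl : ∀ v → ¬ T (Adj v v)
open Graph public

data Walk {n : ℕ} (R : Fin n → Fin n → Set) : Fin n → Fin n → Set where
  []  : ∀ {v} → Walk R v v
  _∷_ : ∀ {u w v} → R u w → Walk R w v → Walk R u v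

len : ∀ {n} {R : Fin n → Fin n → Set} {u v} → Walk R u v → ℕ
len []      = 0
len (_ ∷ w) = suc (len w)

edges : ∀ {n} {R : Fin n → Fin n → Set} {u v} → Walk R u v → List (Fin n × Fin n)
edges []            = []
edges {u = u} (_∷_ {w = w} _ p) = (u , w) ∷ edges p

verts : ∀ {n} {R : Fin n → Fin n → Set} {u v} → Walk R u v → List (Fin n)
verts {u = u} []    = u ∷ []
verts {u = u} (_ ∷ p) = u ∷ verts p

Adjᴳ : ∀ {n} → Graph n → Fin n → Fin n → Set
Adjᴳ G u v = T (Adj G u v)

Connected : ∀ {n} → Graph n → Set
Connected G = ∀ u v → Walk (Adjᴳ G) u v

EdgeSet : ℕ → Set
EdgeSet n = Fin n → Fin n → Bool

IsEdgeSet : ∀ {n} → Graph n → EdgeSet n → Set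
IsEdgeSet G F = (∀ u v → T (F u v) → T (Adj G u v)) × (∀ u v → T (F u v) → T (F v u))

_⊆ₑ_ : ∀ {n} → EdgeSet n → EdgeSet n → Set
F ⊆ₑ F' = ∀ u v → T (F u v) → T (F' u v)

Minus : ∀ {n} → Graph n → EdgeSet n → Fin n → Fin n → Set
Minus G F u v = T (Adj G u v) × ¬ T (F u v)

Disconnects : ∀ {n} → Graph n → EdgeSet n → Set
Disconnects G F = ¬ (∀ u v → Walk (Minus G F) u v)

IsCut : ∀ {n} → Graph n → EdgeSet n → Set
IsCut G C = IsEdgeSet G C × Disconnects G C ×
  (∀ F → IsEdgeSet G F → F ⊆ₑ C → Disconnects G F → C ⊆ₑ F)

IsCutPartition : ∀ {n k} → Graph n → (Fin k → EdgeSet n) → Set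
IsCutPartition {k = k} G Cs = (∀ i → IsCut G (Cs i)) ×
  (∀ u v → T (Adj G u v) → Σ[ i ∈ Fin k ] (T (Cs i u v) × (∀ j → T (Cs j u v) → j ≡ i)))

-- shortest walk (= shortest path) in G
IsShortest : ∀ {n} (G : Graph n) {u v} → Walk (Adjᴳ G) u v → Set
IsShortest G {u} {v} w = ∀ (w' : Walk (Adjᴳ G) u v) → len w ≤ len w'

-- no shortest path contains two (distinct positions, hence distinct) edges of the same cut
NoShortestPathTwoEdges : ∀ {n k} → Graph n → (Fin k → EdgeSet n) → Set
NoShortestPathTwoEdges {k = k} G Cs =
  ∀ u v (w : Walk (Adjᴳ G) u v) → IsShortest G w →
  ∀ (i : Fin k) (p q : Fin (L.length (edges w))) → p ≢ q →
  let (a , b) = L.lookup (edges w) p ; (c , d) = L.lookup (edges w) q in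
  T (Cs i a b) → T (Cs i c d) → ⊥

-- convexity of a vertex set (= of the induced subgraph)
Convex : ∀ {n} → Graph n → Subset n → Set
Convex G S = ∀ u v → u ∈ S → v ∈ S → (w : Walk (Adjᴳ G) u v) → IsShortest G w →
  All (_∈ S) (verts w)

HullIsG : ∀ {n} → Graph n → Subset n → Set
HullIsG G S = ∀ C → Convex G C → S ⊆ C → ∀ x → x ∈ C

IsHullNumber : ∀ {n} → Graph n → ℕ → Set
IsHullNumber G h = (Σ[ S ∈ Subset _ ] (∣ S ∣ ≡ h × HullIsG G S)) ×
  (∀ S → HullIsG G S → h ≤ ∣ S ∣)

-- u lies in V ∖ C(v): u is not reachable from v in G − C
OtherSide : ∀ {n} → Graph n → EdgeSet n → Fin n → Fin n → Set
OtherSide G C v u = ¬ Walk (Minus G C) v u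

Hits : ∀ {n k} → Graph n → (Fin k → EdgeSet n) → Fin n → Subset n → Set
Hits G Cs v S = ∀ i → Σ[ u ∈ Fin _ ] (u ∈ S × OtherSide G (Cs i) v u)

Is-h : ∀ {n k} → Graph n → (Fin k → EdgeSet n) → Fin n → ℕ → Set
Is-h G Cs v m = (Σ[ S ∈ Subset _ ] (∣ S ∣ ≡ m × Hits G Cs v S)) ×
  (∀ S → Hits G Cs v S → m ≤ ∣ S ∣)

IsMin-h : ∀ {n k} → Graph n → (Fin k → EdgeSet n) → ℕ → Set
IsMin-h G Cs m = (Σ[ v ∈ Fin _ ] Is-h G Cs v m) × (∀ v m' → Is-h G Cs v m' → m ≤ m')

module Submission where

-- Write Cᵢ(v) for the component of v in G − Cᵢ.  The proof has four layers.
-- (1) Any cut C of any graph: by minimality, every C-edge joins C(y) to its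
--     complement, for every vertex y; so the ends of a C-edge are separated by
--     C, and in a connected graph every vertex lies in the component of one end.
-- (2) Geodesic property of the partition: a shortest path uses Cᵢ exactly when
--     its ends are separated by Cᵢ.  Counting cut labels, prepending a Cⱼ-edge
--     y y' to a shortest path from y' to z ∈ Cⱼ(y') gives a shortest path.
-- (3) Convexity: each Cᵢ(v) is convex, and a convex set missing a vertex lies
--     inside a single Cⱼ(c) (cut the shortest path towards the missing vertex
--     at its first edge leaving the set).
-- (4) Hence for v ∈ S the hull of S is G iff S ∖ {v} meets V ∖ C(v) for all C.
--     A minimum hitting set for v plus v is a hull set, and deleting any v from
--     a hull set leaves a hitting set for v; this gives both bounds.
-- Finiteness enters through decidability: reachability, shortest walks and
-- minimum hitting sets are found by bounded search.

open import Defs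
open import Data.Nat using (ℕ; zero; suc; _≤_; _<_; z≤n; s≤s)
open import Data.Nat.Properties using (_≟_; ≤-trans; ≤-pred; ≤∧≢⇒<; m<n⇒m<1+n; n<1+n; <⇒≱; suc-injective; module ≤-Reasoning)
open import Data.Fin using (Fin; zero; suc; toℕ; fromℕ<) renaming (_≟_ to _≟ᶠ_)
open import Data.Fin.Properties using (any?; all?; toℕ-fromℕ<)
open import Data.Product as Product using (Σ; ∃; _×_; _,_; proj₁; proj₂)
open import Data.Sum as Sum using (_⊎_; inj₁; inj₂)
open import Data.Bool using (Bool; T)
open import Data.Bool.Properties using (T-≡)
open import Data.Vec as Vec using (_∷_; here; there)
open import Data.Vec.Properties using (lookup∘tabulate; lookup⇒[]=; []=⇒lookup)
open import Data.Fin.Subset using (Subset; inside; outside; _∈_; _∉_; _⊆_; _∪_; ⁅_⁆; _-_; ∣_∣) renaming (⊥ to ∅)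
open import Data.Fin.Subset.Properties
  using (_∈?_; ∪-identityʳ; p⊆p∪q; x∈p∪q⁺; x∈⁅x⁆; x∈p∧x≢y⇒x∈p-y; x∈p⇒∣p-x∣<∣p∣; anySubset?; nonempty?; ∉⊥)
open import Function.Bundles using (Equivalence)
open import Function using (_∘_; case_of_)
open import Data.List as List using (List; []; _∷_; length)
open import Data.List.Properties using (length-removeAt′; length-tabulate)
open import Data.List.Relation.Unary.Any as Any using (here; there; index)
open import Data.List.Relation.Unary.All as All using (All; []; _∷_)
open import Data.List.Relation.Unary.All.Properties using (¬Any⇒All¬)
open import Data.List.Relation.Unary.AllPairs using ([]; _∷_)
open import Data.List.Relation.Unary.Unique.Propositional using (Unique)
open import Data.List.Membership.Propositional using (_─_) renaming (_∈_ to _∈ₗ_)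
open import Data.List.Membership.Propositional.Properties using (∈-allFin)
open import Relation.Nullary using (¬_; Dec; yes; no)
open import Relation.Nullary.Decidable using (_×-dec_; _⊎-dec_; ¬?; T?; ⌊_⌋; toWitness; fromWitness; decidable-stable)
open import Data.Empty using (⊥-elim)
open import Relation.Binary.PropositionalEquality using (_≡_; _≢_; refl; cong; subst; trans) renaming (sym to ≡-sym)

module _ {Q : ℕ → Set} (Q? : ∀ ℓ → Dec (Q ℓ)) where

  private
    search : ∀ b → (∃ λ ℓ → Q ℓ × ℓ < b × (∀ ℓ' → Q ℓ' → ℓ ≤ ℓ')) ⊎ (∀ ℓ' → Q ℓ' → b ≤ ℓ')
    search zero = inj₂ (λ _ _ → z≤n)
    search (suc b) with search b
    ... | inj₁ (ℓ , q , ℓ<b , minimal) = inj₁ (ℓ , q , m<n⇒m<1+n ℓ<b , minimal)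
    ... | inj₂ b≤ with Q? b
    ...   | yes q = inj₁ (b , q , n<1+n b , b≤)
    ...   | no ¬q = inj₂ (λ ℓ' q' → ≤∧≢⇒< (b≤ ℓ' q') (λ { refl → ¬q q' }))

  least : ∀ {ℓ₀} → Q ℓ₀ → ∃ λ ℓ → Q ℓ × ℓ ≤ ℓ₀ × (∀ ℓ' → Q ℓ' → ℓ ≤ ℓ')
  least {ℓ₀} q₀ with search (suc ℓ₀)
  ... | inj₁ (ℓ , q , ℓ<1+ℓ₀ , minimal) = ℓ , q , ≤-pred ℓ<1+ℓ₀ , minimal
  ... | inj₂ above = ⊥-elim (<⇒≱ (n<1+n ℓ₀) (above ℓ₀ q₀))

∈-─ : ∀ {A : Set} {x z : A} {ys : List A} (x∈ys : x ∈ₗ ys) → z ∈ₗ ys → z ≢ x → z ∈ₗ ys ─ x∈ys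
∈-─ (here refl) (here refl)  z≢x = ⊥-elim (z≢x refl)
∈-─ (here refl) (there z∈ys) _   = z∈ys
∈-─ (there _)   (here refl)  _   = here refl
∈-─ (there x∈ys) (there z∈ys) z≢x = there (∈-─ x∈ys z∈ys z≢x)

-- Pigeonhole: a duplicate-free list whose elements all occur in ys is no longer
-- than ys.  Bounds simple walks by n, and shortest walks by their cut labels.
unique-length-≤ : ∀ {A : Set} {xs ys : List A} → Unique xs →
                  (∀ {x} → x ∈ₗ xs → x ∈ₗ ys) → length xs ≤ length ys
unique-length-≤ {xs = []} _ _ = z≤n
unique-length-≤ {xs = x ∷ xs} {ys} (x∉xs ∷ unique) xs⊆ys = begin
  suc (length xs)             ≤⟨ s≤s (unique-length-≤ unique xs⊆ys─x) ⟩
  suc (length (ys ─ x∈ys))    ≡⟨ ≡-sym (length-removeAt′ ys (index x∈ys)) ⟩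
  length ys                   ∎
  where
  open ≤-Reasoning
  x∈ys = xs⊆ys (here refl)
  xs⊆ys─x : ∀ {z} → z ∈ₗ xs → z ∈ₗ ys ─ x∈ys
  xs⊆ys─x z∈xs = ∈-─ x∈ys (xs⊆ys (there z∈xs)) (λ { refl → All.lookup x∉xs z∈xs refl })

∣p∪⁅x⁆∣≡1+∣p∣ : ∀ {n} (p : Subset n) x → x ∉ p → ∣ p ∪ ⁅ x ⁆ ∣ ≡ suc ∣ p ∣
∣p∪⁅x⁆∣≡1+∣p∣ (inside  ∷ p) zero    x∉p = ⊥-elim (x∉p here)
∣p∪⁅x⁆∣≡1+∣p∣ (outside ∷ p) zero    _   = cong (suc ∘ ∣_∣) (∪-identityʳ p)
∣p∪⁅x⁆∣≡1+∣p∣ (inside  ∷ p) (suc x) x∉p = cong suc (∣p∪⁅x⁆∣≡1+∣p∣ p x (x∉p ∘ there))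
∣p∪⁅x⁆∣≡1+∣p∣ (outside ∷ p) (suc x) x∉p = ∣p∪⁅x⁆∣≡1+∣p∣ p x (x∉p ∘ there)

∈-tabulate⁺ : ∀ {n} (f : Fin n → Bool) {u} → T (f u) → u ∈ Vec.tabulate f
∈-tabulate⁺ f {u} t = lookup⇒[]= u (Vec.tabulate f) (trans (lookup∘tabulate f u) (Equivalence.to T-≡ t))

∈-tabulate⁻ : ∀ {n} (f : Fin n → Bool) {u} → u ∈ Vec.tabulate f → T (f u)
∈-tabulate⁻ f {u} u∈ = Equivalence.from T-≡ (trans (≡-sym (lookup∘tabulate f u)) ([]=⇒lookup u∈))

module Walks {n : ℕ} {R : Fin n → Fin n → Set} where

  infixr 5 _++ʷ_
  _++ʷ_ : ∀ {a b c} → Walk R a b → Walk R b c → Walk R a c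
  []      ++ʷ q = q
  (e ∷ p) ++ʷ q = e ∷ (p ++ʷ q)

  reverse : (∀ {a b} → R a b → R b a) → ∀ {a b} → Walk R a b → Walk R b a
  reverse R-sym []      = []
  reverse R-sym (e ∷ p) = reverse R-sym p ++ʷ (R-sym e ∷ [])

  suffixFrom : ∀ {a b u} (p : Walk R a b) → u ∈ₗ verts p → Walk R u b
  suffixFrom []      (here refl)  = []
  suffixFrom (e ∷ p) (here refl)  = e ∷ p
  suffixFrom (e ∷ p) (there u∈p) = suffixFrom p u∈p

  suffixFrom-unique : ∀ {a b u} (p : Walk R a b) (u∈p : u ∈ₗ verts p) →
                      Unique (verts p) → Unique (verts (suffixFrom p u∈p))
  suffixFrom-unique []      (here refl)  uniq       = uniq
  suffixFrom-unique (e ∷ p) (here refl)  uniq       = uniq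
  suffixFrom-unique (e ∷ p) (there u∈p) (_ ∷ uniq) = suffixFrom-unique p u∈p uniq

  toPath : ∀ {a b} → Walk R a b → Σ (Walk R a b) (λ w → Unique (verts w))
  toPath []      = [] , ([] ∷ [])
  toPath {a} (e ∷ p) with toPath p
  ... | p' , uniq with Any.any? (a ≟ᶠ_) (verts p')
  ...   | yes a∈p' = suffixFrom p' a∈p' , suffixFrom-unique p' a∈p' uniq
  ...   | no  a∉p' = e ∷ p' , (¬Any⇒All¬ (verts p') a∉p' ∷ uniq)

  length-verts : ∀ {a b} (w : Walk R a b) → length (verts w) ≡ suc (len w)
  length-verts []      = refl
  length-verts (e ∷ p) = cong suc (length-verts p)

  path-length< : ∀ {a b} (w : Walk R a b) → Unique (verts w) → len w < n
  path-length< w uniq = begin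
    suc (len w)              ≡⟨ ≡-sym (length-verts w) ⟩
    length (verts w)         ≤⟨ unique-length-≤ uniq (λ {x} _ → ∈-allFin x) ⟩
    length (List.allFin n)   ≡⟨ length-tabulate (λ x → x) ⟩
    n                        ∎
    where open ≤-Reasoning

  module Decide (R? : ∀ a b → Dec (R a b)) where

    walkOfLength? : ∀ ℓ a b → Dec (∃ λ (w : Walk R a b) → len w ≡ ℓ)
    walkOfLength? zero a b with a ≟ᶠ b
    ... | yes refl = yes ([] , refl)
    ... | no  a≢b  = no λ { ([] , _) → a≢b refl ; (_ ∷ _ , ()) }
    walkOfLength? (suc ℓ) a b with any? (λ c → R? a c ×-dec walkOfLength? ℓ c b)
    ... | yes (c , e , w , len≡) = yes (e ∷ w , cong suc len≡)
    ... | no  none = no λ { ([] , ())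
                          ; (_∷_ {w = c} e w , len≡) → none (c , e , w , suc-injective len≡) }

    -- reachability is decidable: it suffices to look for paths, of length < n
    reachable? : ∀ a b → Dec (Walk R a b)
    reachable? a b with any? (λ (ℓ : Fin n) → walkOfLength? (toℕ ℓ) a b)
    ... | yes (_ , w , _) = yes w
    ... | no  none        = no λ w →
      let (path , uniq) = toPath w
          short          = path-length< path uniq
      in none (fromℕ< short , path , ≡-sym (toℕ-fromℕ< short))

    shortest : ∀ {a b} → Walk R a b → Σ (Walk R a b) (λ w → ∀ w' → len w ≤ len w')
    shortest {a} {b} w₀ with least (λ ℓ → walkOfLength? ℓ a b) (w₀ , refl)
    ... | _ , (w , refl) , _ , minimal = w , λ w' → minimal (len w') (w' , refl)

module Cut {n : ℕ} (G : Graph n) (C : EdgeSet n) (isCut : IsCut G C) where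
  open Walks

  Joined : Fin n → Fin n → Set
  Joined = Walk (Minus G C)

  disconnected : ¬ (∀ u v → Joined u v)
  disconnected = proj₁ (proj₂ isCut)

  joined? : ∀ u v → Dec (Joined u v)
  joined? = Decide.reachable? (λ a b → T? (Adj G a b) ×-dec ¬? (T? (C a b)))

  C-sym : ∀ {u v} → T (C u v) → T (C v u)
  C-sym = proj₂ (proj₁ isCut) _ _

  Joined-sym : ∀ {u v} → Joined u v → Joined v u
  Joined-sym = reverse λ {u} {v} (e , ¬c) → sym G u v e , λ c → ¬c (C-sym c)

  step : ∀ {u v} → T (Adj G u v) → ¬ T (C u v) → Joined u v
  step e ¬c = (e , ¬c) ∷ []

  Splits : Fin n → Fin n → Fin n → Set
  Splits y u v = (Joined y u × ¬ Joined y v) ⊎ (¬ Joined y u × Joined y v)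

  splits? : ∀ y u v → Dec (Splits y u v)
  splits? y u v = (joined? y u ×-dec ¬? (joined? y v)) ⊎-dec (¬? (joined? y u) ×-dec joined? y v)

  splits-sym : ∀ {y u v} → Splits y u v → Splits y v u
  splits-sym = Sum.swap ∘ Sum.map Product.swap Product.swap

  leaving? : ∀ y u v → Dec (T (C u v) × Splits y u v)
  leaving? y u v = T? (C u v) ×-dec splits? y u v

  leaving : Fin n → EdgeSet n
  leaving y u v = ⌊ leaving? y u v ⌋

  leaving-elim : ∀ {y u v} → T (leaving y u v) → T (C u v) × Splits y u v
  leaving-elim {y} {u} {v} = toWitness {a? = leaving? y u v}

  leaving-intro : ∀ {y u v} → T (C u v) → Splits y u v → T (leaving y u v)
  leaving-intro {y} {u} {v} c s = fromWitness {a? = leaving? y u v} (c , s)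

  leaving-edgeSet : ∀ y → IsEdgeSet G (leaving y)
  leaving-edgeSet y = (λ u v l → proj₁ (proj₁ isCut) u v (proj₁ (leaving-elim l)))
                    , (λ u v l → let (c , s) = leaving-elim l in leaving-intro (C-sym c) (splits-sym s))

  stays : ∀ {y u a} → Walk (Minus G (leaving y)) u a → Joined y u → Joined y a
  stays [] y~u = y~u
  stays {y} {u} (_∷_ {w = v} (e , ¬leaves) p) y~u = stays p (next (T? (C u v)))
    where
    next : Dec (T (C u v)) → Joined y v
    next (no ¬c) = y~u ++ʷ step e ¬c
    next (yes c) = decidable-stable (joined? y v)
                     λ y≁v → ¬leaves (leaving-intro c (inj₁ (y~u , y≁v)))

  -- every edge of C leaves the component of y, for every y: otherwise the
  -- edges leaving it would form a smaller disconnecting set, against minimality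
  crosses : ∀ y {u v} → T (C u v) → Splits y u v
  crosses y {u} {v} c =
    proj₂ (leaving-elim (proj₂ (proj₂ isCut) (leaving y) (leaving-edgeSet y) leaving⊆C disconnects u v c))
    where
    leaving⊆C : leaving y ⊆ₑ C
    leaving⊆C u v l = proj₁ (leaving-elim l)
    disconnects : Disconnects G (leaving y)
    disconnects connected =
      disconnected λ a b → Joined-sym (stays (connected y a) []) ++ʷ stays (connected y b) []

  cut-edge-separates : ∀ {u v} → T (C u v) → ¬ Joined u v
  cut-edge-separates {u} c with crosses u c
  ... | inj₁ (_ , u≁v) = u≁v
  ... | inj₂ (u≁u , _) = ⊥-elim (u≁u [])

  other-end : Connected G → ∀ {y y' z} → T (C y y') → ¬ Joined y z → Joined y' z
  other-end connected {y} {y'} {z} c = towards (connected z y')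
    where
    towards : ∀ {u} → Walk (Adjᴳ G) u y' → ¬ Joined y u → Joined y' u
    towards [] _ = []
    towards {u} (_∷_ {w = u₁} e p) y≁u with T? (C u u₁)
    ... | no ¬c = towards p (λ y~u₁ → y≁u (y~u₁ ++ʷ Joined-sym (step e ¬c))) ++ʷ Joined-sym (step e ¬c)
    ... | yes c' with crosses y c' | crosses y' c'
    ...   | inj₁ (y~u , _) | _                = ⊥-elim (y≁u y~u)
    ...   | inj₂ _         | inj₁ (y'~u , _)  = y'~u
    ...   | inj₂ (_ , y~u₁) | inj₂ (_ , y'~u₁) = ⊥-elim (cut-edge-separates c (y~u₁ ++ʷ Joined-sym y'~u₁))

module Geodesic {n k : ℕ} (G : Graph n) (Cs : Fin k → EdgeSet n) (connected : Connected G)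
  (partition : IsCutPartition G Cs) (noSP : NoShortestPathTwoEdges G Cs) where
  open Walks
  open module Cutᵢ (i : Fin k) = Cut G (Cs i) (proj₁ partition i)

  shortest-walk : ∀ {a b} → Walk (Adjᴳ G) a b → Σ (Walk (Adjᴳ G) a b) (IsShortest G)
  shortest-walk = Decide.shortest (λ a b → T? (Adj G a b))

  suffix-shortest : ∀ {a c b} (e : Adjᴳ G a c) {p : Walk (Adjᴳ G) c b} →
                    IsShortest G (e ∷ p) → IsShortest G p
  suffix-shortest e shortest w = ≤-pred (shortest (e ∷ w))

  label : ∀ {a b} → Adjᴳ G a b → Fin k
  label {a} {b} e = proj₁ (proj₂ partition a b e)

  label-cut : ∀ {a b} (e : Adjᴳ G a b) → T (Cs (label e) a b)
  label-cut {a} {b} e = proj₁ (proj₂ (proj₂ partition a b e))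

  label-unique : ∀ {a b} (e : Adjᴳ G a b) i → T (Cs i a b) → i ≡ label e
  label-unique {a} {b} e = proj₂ (proj₂ (proj₂ partition a b e))

  labels : ∀ {a b} → Walk (Adjᴳ G) a b → List (Fin k)
  labels []      = []
  labels (e ∷ p) = label e ∷ labels p

  length-labels : ∀ {a b} (w : Walk (Adjᴳ G) a b) → length (labels w) ≡ len w
  length-labels []      = refl
  length-labels (e ∷ p) = cong suc (length-labels p)

  avoiding : ∀ i {a b} (w : Walk (Adjᴳ G) a b) → ¬ i ∈ₗ labels w → Joined i a b
  avoiding i []      _     = []
  avoiding i (e ∷ p) i∉e∷p =
    step i e (λ c → i∉e∷p (here (label-unique e i c))) ++ʷ avoiding i p (i∉e∷p ∘ there)

  position : ∀ i {a b} (w : Walk (Adjᴳ G) a b) → i ∈ₗ labels w →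
             Σ (Fin (length (edges w))) λ q → let (u , v) = List.lookup (edges w) q in T (Cs i u v)
  position i (e ∷ p) (here refl) = zero , label-cut e
  position i (e ∷ p) (there i∈p) = let (q , c) = position i p i∈p in suc q , c

  shortest-labels-unique : ∀ {a b} (w : Walk (Adjᴳ G) a b) → IsShortest G w → Unique (labels w)
  shortest-labels-unique [] _ = []
  shortest-labels-unique {a} {b} (e ∷ p) shortest =
    ¬Any⇒All¬ (labels p) (λ label∈p → let (q , c) = position (label e) p label∈p in
      noSP a b (e ∷ p) shortest (label e) zero (suc q) (λ ()) (label-cut e) c)
    ∷ shortest-labels-unique p (suffix-shortest e shortest)

  -- a shortest path using an edge of Cᵢ has its ends in different components
  -- of G − Cᵢ: that edge is its only crossing of Cᵢ
  shortest-crossing-separates : ∀ i {a b} (w : Walk (Adjᴳ G) a b) → IsShortest G w →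
                                i ∈ₗ labels w → ¬ Joined i a b
  shortest-crossing-separates i (e ∷ p) shortest i∈e∷p a~b
    with shortest-labels-unique (e ∷ p) shortest | i∈e∷p
  ... | label∉p ∷ _ | here refl =
    cut-edge-separates i (label-cut e)
      (a~b ++ʷ Joined-sym i (avoiding i p (λ i∈p → All.lookup label∉p i∈p refl)))
  ... | label∉p ∷ _ | there i∈p =
    shortest-crossing-separates i p (suffix-shortest e shortest) i∈p
      (Joined-sym i (step i e (λ c → All.lookup label∉p i∈p (≡-sym (label-unique e i c)))) ++ʷ a~b)

  -- prepending an edge e = y y' to a shortest path Q from y' to a vertex z in the
  -- component of y' in G − C_(label e) gives a shortest path: the labels of e ∷ Q
  -- are distinct and each of them is used by every walk from y to z
  extend-shortest : ∀ {y y' z} (e : Adjᴳ G y y') (Q : Walk (Adjᴳ G) y' z) → IsShortest G Q →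
                    Joined (label e) y' z → IsShortest G (e ∷ Q)
  extend-shortest {y} {y'} {z} e Q shortest y'~z w = begin
    suc (len Q)                ≡⟨ cong suc (≡-sym (length-labels Q)) ⟩
    length (labels (e ∷ Q))    ≤⟨ unique-length-≤ distinct used ⟩
    length (labels w)          ≡⟨ length-labels w ⟩
    len w                      ∎
    where
    open ≤-Reasoning
    distinct : Unique (labels (e ∷ Q))
    distinct = ¬Any⇒All¬ (labels Q) (λ label∈Q → shortest-crossing-separates _ Q shortest label∈Q y'~z)
             ∷ shortest-labels-unique Q shortest
    used : ∀ {i} → i ∈ₗ labels (e ∷ Q) → i ∈ₗ labels w
    used {i} i∈e∷Q = decidable-stable (Any.any? (i ≟ᶠ_) (labels w)) λ i∉w →
      let y~z = avoiding i w i∉w in case i∈e∷Q of λ where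
        (here refl) → cut-edge-separates i (label-cut e) (y~z ++ʷ Joined-sym i y'~z)
        (there i∈Q) → shortest-crossing-separates i Q shortest i∈Q (case T? (Cs i y y') of λ where
          (yes c) → subst (λ j → Joined j y' z) (≡-sym (label-unique e i c)) y'~z
          (no ¬c) → Joined-sym i (step i e ¬c) ++ʷ y~z)

  side : Fin k → Fin n → Subset n
  side i v = Vec.tabulate (λ u → ⌊ joined? i v u ⌋)

  side-intro : ∀ i v {u} → Joined i v u → u ∈ side i v
  side-intro i v v~u = ∈-tabulate⁺ _ (fromWitness v~u)

  side-elim : ∀ i v {u} → u ∈ side i v → Joined i v u
  side-elim i v u∈ = toWitness (∈-tabulate⁻ _ u∈)

  -- components of G − Cᵢ are convex: a shortest path between two vertices of
  -- one component cannot use Cᵢ, so it stays inside the component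
  side-convex : ∀ i v → Convex G (side i v)
  side-convex i v a b a∈ b∈ w shortest = along w i∉w (side-elim i v a∈)
    where
    i∉w : ¬ i ∈ₗ labels w
    i∉w i∈w = shortest-crossing-separates i w shortest i∈w
                (Joined-sym i (side-elim i v a∈) ++ʷ side-elim i v b∈)
    along : ∀ {a' b'} (w' : Walk (Adjᴳ G) a' b') → ¬ i ∈ₗ labels w' → Joined i v a' →
            All (_∈ side i v) (verts w')
    along []       _      v~a' = side-intro i v v~a' ∷ []
    along (e ∷ w') i∉e∷w' v~a' = side-intro i v v~a'
      ∷ along w' (i∉e∷w' ∘ there) (v~a' ++ʷ step i e (λ c → i∉e∷w' (here (label-unique e i c))))

  start∈ : ∀ {P : Fin n → Set} {a b} (w : Walk (Adjᴳ G) a b) → All P (verts w) → P a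
  start∈ []      (Pa ∷ _) = Pa
  start∈ (_ ∷ _) (Pa ∷ _) = Pa

  -- a convex set K missing a vertex x lies inside one component of some G − Cⱼ:
  -- on a shortest path from y ∈ K to x, take the first edge y y' leaving K.  If
  -- some z ∈ K were separated from y by C_(label e), then z would lie in the
  -- component of y', and y' would be on a shortest path from y to z, so in K.
  convex-within-side : ∀ K → Convex G K → ∀ {x y} → x ∉ K → y ∈ K →
                       ∃ λ j → ∃ λ c → ∀ {z} → z ∈ K → Joined j c z
  convex-within-side K convex {x} x∉K y∈K = exit (proj₁ (shortest-walk (connected _ x))) y∈K
                                                  (proj₂ (shortest-walk (connected _ x)))
    where
    exit : ∀ {y} (P : Walk (Adjᴳ G) y x) → y ∈ K → IsShortest G P →
           ∃ λ j → ∃ λ c → ∀ {z} → z ∈ K → Joined j c z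
    exit []                     y∈K _        = ⊥-elim (x∉K y∈K)
    exit {y} (_∷_ {w = y'} e P) y∈K shortest with y' ∈? K
    ... | yes y'∈K = exit P y'∈K (suffix-shortest e shortest)
    ... | no  y'∉K = label e , y , λ {z} z∈K → decidable-stable (joined? (label e) y z) λ y≁z →
      let (Q , Q-shortest) = shortest-walk (connected y' z)
          y'~z             = other-end (label e) connected (label-cut e) y≁z
          eQ-shortest      = extend-shortest e Q Q-shortest y'~z
      in y'∉K (start∈ Q (All.tail (convex y z y∈K z∈K (e ∷ Q) eQ-shortest)))

  far-≢ : ∀ {i v u} → OtherSide G (Cs i) v u → u ≢ v
  far-≢ far refl = far []

  hits-without : ∀ {v S} → Hits G Cs v S → Hits G Cs v (S - v)
  hits-without hits i = let (u , u∈S , far) = hits i in u , x∈p∧x≢y⇒x∈p-y u∈S (far-≢ far) , far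

  -- if v ∈ S and S meets the far side of every cut seen from v, the convex
  -- hull of S is G: a convex superset K ≠ V would lie in one component of some
  -- G − Cⱼ, yet contain v and a vertex separated from v by Cⱼ
  hitting-hull : ∀ S v → v ∈ S → Hits G Cs v S → HullIsG G S
  hitting-hull S v v∈S hits K convex S⊆K x = decidable-stable (x ∈? K) λ x∉K →
    let (j , c , K⊆side) = convex-within-side K convex x∉K (S⊆K v∈S)
        (u , u∈S , far)  = hits j
    in far (Joined-sym j (K⊆side (S⊆K v∈S)) ++ʷ K⊆side (S⊆K u∈S))

  -- conversely, for a hull set S and any v, S ∖ {v} meets the far side of
  -- every cut Cᵢ seen from v: otherwise S lies in the convex component of v in
  -- G − Cᵢ, which would then be all of G, although Cᵢ disconnects G
  hull-hitting : ∀ S v → HullIsG G S → Hits G Cs v (S - v)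
  hull-hitting S v hull i =
    decidable-stable (any? λ u → (u ∈? (S - v)) ×-dec ¬? (joined? i v u)) λ none →
      let S⊆side : S ⊆ side i v
          S⊆side {u} u∈S = side-intro i v (decidable-stable (joined? i v u) λ v≁u →
                              none (u , x∈p∧x≢y⇒x∈p-y u∈S (far-≢ v≁u) , v≁u))
          everywhere = hull (side i v) (side-convex i v) S⊆side
      in disconnected i λ a b → Joined-sym i (side-elim i v (everywhere a)) ++ʷ side-elim i v (everywhere b)

  hits? : ∀ v S → Dec (Hits G Cs v S)
  hits? v S = all? λ i → any? λ u → (u ∈? S) ×-dec ¬? (joined? i v u)

  h-exists : ∀ v S → Hits G Cs v S → ∃ λ h → Is-h G Cs v h × h ≤ ∣ S ∣
  h-exists v S hits
    with least (λ h → anySubset? λ S' → (∣ S' ∣ ≟ h) ×-dec hits? v S') (S , refl , hits)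
  ... | h , witness , h≤∣S∣ , minimal = h , (witness , λ S' hits' → minimal ∣ S' ∣ (S' , refl , hits')) , h≤∣S∣

  -- upper bound: a minimum hitting set S for v avoids v (else S ∖ {v} would be
  -- smaller), and S ∪ {v} is a hull set of size h_v + 1
  hull-set : ∀ v {h} → Is-h G Cs v h → ∃ λ S → ∣ S ∣ ≡ suc h × HullIsG G S
  hull-set v ((S , ∣S∣≡h , hits) , minimal) =
    S ∪ ⁅ v ⁆ , trans (∣p∪⁅x⁆∣≡1+∣p∣ S v v∉S) (cong suc ∣S∣≡h) ,
    hitting-hull (S ∪ ⁅ v ⁆) v (x∈p∪q⁺ (inj₂ (x∈⁅x⁆ v)))
      (λ i → let (u , u∈S , far) = hits i in u , p⊆p∪q ⁅ v ⁆ u∈S , far)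
    where
    v∉S : v ∉ S
    v∉S v∈S = <⇒≱ (subst (∣ S - v ∣ <_) ∣S∣≡h (x∈p⇒∣p-x∣<∣p∣ v∈S)) (minimal (S - v) (hits-without hits))

  -- lower bound: removing any vertex v from a hull set S leaves a hitting set
  -- for v, so |S| ≥ h_v + 1 ≥ min h + 1 (S is nonempty as the empty set is convex)
  hull-set-bound : ∀ {m} → IsMin-h G Cs m → ∀ S → HullIsG G S → suc m ≤ ∣ S ∣
  hull-set-bound ((v₀ , _) , minimal) S hull with nonempty? S
  ... | no  empty    = ⊥-elim (∉⊥ (hull ∅ (λ _ _ u∈∅ → ⊥-elim (∉⊥ u∈∅)) (λ u∈S → ⊥-elim (empty (_ , u∈S))) v₀))
  ... | yes (v , v∈S) =
    let (h , is-h , h≤) = h-exists v (S - v) (hull-hitting S v hull)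
    in ≤-trans (s≤s (≤-trans (minimal v h is-h) h≤)) (x∈p⇒∣p-x∣<∣p∣ v∈S)

corollary2 : ∀ {n k : ℕ} (G : Graph n) (Cs : Fin k → EdgeSet n) →
    Connected G → IsCutPartition G Cs → NoShortestPathTwoEdges G Cs →
    ∀ m → IsMin-h G Cs m → IsHullNumber G (suc m)
corollary2 G Cs connected partition noSP m min-h@((v , is-h) , _) =
  hull-set v is-h , hull-set-bound min-h
  where open Geodesic G Cs connected partition noSP
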